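{- Let $A$ be a finite alphabet with $|A|\ge 2$. If $L\subseteq A^*$ is regular and $m\geq 0$, then $L^+(m)\in\mathcal{L}_{1/2}$ and $L^-(m)\in\mathcal{L}_{1/2}$.
   Context: $\mathcal{L}_{1/2}$ is the class of finite unions of languages $A^*a_1A^*a_2A^*\cdots A^*a_nA^*$ ($n\geq 0$, $a_i\in A$). Subword relation: $w\sqsubseteq v$ iff there are $n\geq 0$, $a_1,\dots,a_n\in A$, $v_0,\dots,v_n\in A^*$ with $w=a_1\cdots a_n$ and $v=v_0a_1v_1\cdots a_nv_n$. For $m\geq 0$ and $w,v\in A^*$, write $w\to^m_L v$ iff there exist $w_0,\dots,w_m\in A^*$ with $w=w_0\sqsubseteq w_1\sqsubseteq\cdots\sqsubseteq w_m\sqsubseteq v$ and ($w_i\in L\iff w_{i+1}\notin L$) for $0\leq i\leq m-1$. Define $L^+(m)=\{v:\exists w\in L,\ w\to^m_L v\}$ and $L^-(m)=\{v:\exists w\notin L,\ w\to^m_L v\}$. -}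

module Defs where

open import Data.Nat using (ℕ; zero; suc)
open import Data.Fin using (Fin)
open import Data.Bool using (Bool; true)
open import Data.List using (List; []; _∷_; _++_; foldl)
open import Data.List.Relation.Unary.Any using (Any)
open import Data.Product using (Σ; ∃; _×_)
open import Data.Unit using (⊤)
open import Relation.Nullary using (¬_)
open import Relation.Binary.PropositionalEquality using (_≡_)
open import Function.Bundles using (_⇔_)

Lang : Set → Set₁
Lang A = List A → Set

record DFA (A : Set) (n : ℕ) : Set where
  field
    δ      : Fin n → A → Fin n
    start  : Fin n
    final  : Fin n → Bool

accepts : {A : Set} {n : ℕ} → DFA A n → List A → Set
accepts D w = DFA.final D (foldl (DFA.δ D) (DFA.start D) w) ≡ true

Regular : {A : Set} → Lang A → Set
Regular {A} L = Σ ℕ λ n → Σ (DFA A n) λ D → ∀ w → L w ⇔ accepts D w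

-- The language A* a₁ A* a₂ A* ⋯ A* aₙ A*  for the word a₁⋯aₙ.
Pattern : {A : Set} → List A → Lang A
Pattern []      v = ⊤
Pattern (a ∷ w) v = Σ _ λ u → Σ _ λ x → (v ≡ u ++ (a ∷ x)) × Pattern w x

InL½ : {A : Set} → Lang A → Set
InL½ {A} X = Σ (List (List A)) λ ps → ∀ v → X v ⇔ Any (λ p → Pattern p v) ps

data _⊑_ {A : Set} : List A → List A → Set where
  []⊑  : [] ⊑ []
  skip : ∀ {w v} a → w ⊑ v → w ⊑ (a ∷ v)
  keep : ∀ {w v} a → w ⊑ v → (a ∷ w) ⊑ (a ∷ v)

data Chain {A : Set} (L : Lang A) : ℕ → List A → List A → Set where
  done : ∀ {w v} → w ⊑ v → Chain L zero w v
  step : ∀ {m w w' v} → w ⊑ w' → (L w ⇔ (¬ L w')) → Chain L m w' v → Chain L (suc m) w v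

Lplus : {A : Set} → Lang A → ℕ → Lang A
Lplus L m v = ∃ λ w → L w × Chain L m w v

Lminus : {A : Set} → Lang A → ℕ → Lang A
Lminus L m v = ∃ λ w → (¬ L w) × Chain L m w v

{-# OPTIONS --safe #-}
module Submission where

-- A chain w₀ ⊑ ⋯ ⊑ w_m ⊑ v is recorded as one word over A × {0,…,m} whose erasure is a subword
-- of v. Whether the chain alternates, and on which side of L it starts, depends only on the tuple of
-- DFA states reached by its m + 1 layers, and that tuple is compatible with right concatenation.
-- Pigeonhole on prefixes therefore shortens every such labelled word to one of length ≤ n^(m+1)
-- encoding a chain of the same kind, with an erasure that is still a subword. So L±(m) is the union
-- of A*a₁A*⋯a_kA* over the erasures a₁⋯a_k of finitely many short labelled words.

open import Defs
open import Data.Bool using (Bool; true; false; not; if_then_else_)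
open import Data.Bool.Properties using (T-≡) renaming (_≟_ to _≟ᵇ_)
open import Data.Empty using (⊥-elim)
open import Data.Fin using (Fin; zero; suc; toℕ; fromℕ<; funToFin; finToFun; combine)
open import Data.Fin.Properties using (pigeonhole; finToFun-funToFin; toℕ-fromℕ<; toℕ<n)
open import Data.List
  using ( List; []; _∷_; [_]; _++_; foldl; map; filter; length; take; drop; allFin
        ; cartesianProduct; cartesianProductWith)
open import Data.List.Properties
  using ( ++-assoc; foldl-++; length-++; length-take; length-drop; take-take; take++drop≡id
        ; map-∘; map-id)
open import Data.List.Membership.Propositional using (_∈_; find; lose)
open import Data.List.Membership.Propositional.Properties
  using (∈-allFin; ∈-cartesianProduct⁺; ∈-cartesianProductWith⁺; ∈-filter⁺; ∈-filter⁻; ∈-map⁺; ∈-map⁻)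
open import Data.List.Relation.Binary.Sublist.Propositional using (_⊆_; []; _∷_; _∷ʳ_; ⊆-refl; ⊆-trans)
open import Data.List.Relation.Binary.Sublist.Propositional.Properties
  using ([]⊆-universal; ++⁺; ++⁺ˡ; map⁺)
open import Data.List.Relation.Unary.Any using (Any; here; there)
open import Data.Nat using (ℕ; zero; suc; _≤ᵇ_; _≤_; _<_; _≥_; _+_; _∸_; _⊓_; _^_; z≤n; s≤s)
open import Data.Nat.Induction using (<-wellFounded)
open import Data.Nat.Properties
  using ( _≤?_; ≤ᵇ-reflects-≤; ≤-trans; <⇒≤; ≤-pred; m≤n⇒m≤1+n; ≰⇒>; n<1+n; m<n⇒0<n∸m; m≤n⇒m⊓n≡m
        ; +-monoʳ-<; m<n+m; module ≤-Reasoning)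
open import Data.Product using (_×_; ∃; ∃₂; _,_; proj₁; proj₂)
open import Data.Unit using (⊤; tt)
open import Function using (_∘_; const; flip)
open import Function.Bundles using (_⇔_; mk⇔; Equivalence)
open import Function.Properties.Equivalence using () renaming (trans to ⇔-trans)
open import Induction.WellFounded using (Acc; acc)
open import Relation.Binary.PropositionalEquality
  using (_≡_; _≗_; refl; sym; trans; cong; cong₂; subst; subst₂; module ≡-Reasoning)
open import Relation.Nullary using (¬_; Dec; yes; no; contradiction)
open import Relation.Nullary.Decidable using (_×-dec_)
open import Relation.Nullary.Reflects using (Reflects; ofʸ; ofⁿ; ¬-reflects; fromEquivalence)

Reflects-⇔ : ∀ {P Q : Set} {b c} → Reflects P b → Reflects Q c → (P ⇔ Q) ⇔ (b ≡ c)
Reflects-⇔ (ofʸ p)  (ofʸ q)  = mk⇔ (const refl) (const (mk⇔ (const q) (const p)))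
Reflects-⇔ (ofʸ p)  (ofⁿ ¬q) = mk⇔ (λ p⇔q → ⊥-elim (¬q (Equivalence.to p⇔q p))) λ ()
Reflects-⇔ (ofⁿ ¬p) (ofʸ q)  = mk⇔ (λ p⇔q → ⊥-elim (¬p (Equivalence.from p⇔q q))) λ ()
Reflects-⇔ (ofⁿ ¬p) (ofⁿ ¬q) = mk⇔ (const refl) (const (mk⇔ (⊥-elim ∘ ¬p) (⊥-elim ∘ ¬q)))

Reflects-if-⇔ : ∀ {P : Set} {b} → Reflects P b → ∀ c → (if c then P else ¬ P) ⇔ (b ≡ c)
Reflects-if-⇔ (ofʸ p)  true  = mk⇔ (const refl) (const p)
Reflects-if-⇔ (ofʸ p)  false = mk⇔ (λ ¬p → ⊥-elim (¬p p)) λ ()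
Reflects-if-⇔ (ofⁿ ¬p) true  = mk⇔ (λ p → ⊥-elim (¬p p)) λ ()
Reflects-if-⇔ (ofⁿ ¬p) false = mk⇔ (const refl) (const ¬p)

funToFin-cong : ∀ {m n} {f g : Fin m → Fin n} → f ≗ g → funToFin f ≡ funToFin g
funToFin-cong {zero}  _   = refl
funToFin-cong {suc m} f≗g = cong₂ combine (f≗g zero) (funToFin-cong (f≗g ∘ suc))

funToFin-injective : ∀ {m n} {f g : Fin m → Fin n} → funToFin f ≡ funToFin g → f ≗ g
funToFin-injective {f = f} {g} eq i =
  trans (sym (finToFun-funToFin f i)) (trans (cong (λ c → finToFun c i) eq) (finToFun-funToFin g i))

module _ {A : Set} where

  ⊑⇒⊆ : ∀ {w v : List A} → w ⊑ v → w ⊆ v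
  ⊑⇒⊆ []⊑        = []
  ⊑⇒⊆ (skip a p) = a ∷ʳ ⊑⇒⊆ p
  ⊑⇒⊆ (keep a p) = refl ∷ ⊑⇒⊆ p

  ⊆⇒⊑ : ∀ {w v : List A} → w ⊆ v → w ⊑ v
  ⊆⇒⊑ []         = []⊑
  ⊆⇒⊑ (a ∷ʳ p)   = skip a (⊆⇒⊑ p)
  ⊆⇒⊑ (refl ∷ p) = keep _ (⊆⇒⊑ p)

  Pattern⇒⊆ : ∀ p {v : List A} → Pattern p v → p ⊆ v
  Pattern⇒⊆ []      {v} _                  = []⊆-universal v
  Pattern⇒⊆ (a ∷ p) (u , x , refl , match) = ++⁺ˡ u (refl ∷ Pattern⇒⊆ p match)

  ⊆⇒Pattern : ∀ {p v : List A} → p ⊆ v → Pattern p v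
  ⊆⇒Pattern {[]}    _ = tt
  ⊆⇒Pattern {_ ∷ _} (b ∷ʳ p⊆v) with ⊆⇒Pattern p⊆v
  ... | u , x , refl , match = b ∷ u , x , refl , match
  ⊆⇒Pattern {_ ∷ _} (refl ∷ p⊆v) = [] , _ , refl , ⊆⇒Pattern p⊆v

module _ {B : Set} where

  prefix-pigeonhole : ∀ {M} (f : List B → Fin M) w → M < length w →
    ∃₂ λ x y → ∃ λ z → w ≡ x ++ y ++ z × 0 < length y × f x ≡ f (x ++ y)
  prefix-pigeonhole {M} f w M<∣w∣
    with i , j , i<j , fi≡fj ← pigeonhole (n<1+n M) (λ i → f (take (toℕ i) w))
    = x , y , z , sym xyz≡w , 0<∣y∣ , trans fi≡fj (cong f (sym xy≡take-j))
    where
    open ≡-Reasoning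
    x = take (toℕ i) w
    y = drop (toℕ i) (take (toℕ j) w)
    z = drop (toℕ j) w

    xy≡take-j : x ++ y ≡ take (toℕ j) w
    xy≡take-j = begin
      take (toℕ i) w ++ y                ≡⟨ cong (λ k → take k w ++ y) (m≤n⇒m⊓n≡m (<⇒≤ i<j)) ⟨
      take (toℕ i ⊓ toℕ j) w ++ y        ≡⟨ cong (_++ y) (take-take (toℕ i) (toℕ j) w) ⟨
      take (toℕ i) (take (toℕ j) w) ++ y ≡⟨ take++drop≡id (toℕ i) (take (toℕ j) w) ⟩
      take (toℕ j) w                     ∎

    xyz≡w : x ++ y ++ z ≡ w
    xyz≡w = begin
      x ++ y ++ z          ≡⟨ ++-assoc x y z ⟨
      (x ++ y) ++ z        ≡⟨ cong (_++ z) xy≡take-j ⟩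
      take (toℕ j) w ++ z  ≡⟨ take++drop≡id (toℕ j) w ⟩
      w                    ∎

    ∣y∣≡j∸i : length y ≡ toℕ j ∸ toℕ i
    ∣y∣≡j∸i = begin
      length y                        ≡⟨ length-drop (toℕ i) (take (toℕ j) w) ⟩
      length (take (toℕ j) w) ∸ toℕ i ≡⟨ cong (_∸ toℕ i) (length-take (toℕ j) w) ⟩
      toℕ j ⊓ length w ∸ toℕ i        ≡⟨ cong (_∸ toℕ i) (m≤n⇒m⊓n≡m j≤∣w∣) ⟩
      toℕ j ∸ toℕ i                   ∎
      where
      j≤∣w∣ : toℕ j ≤ length w
      j≤∣w∣ = ≤-trans (≤-pred (toℕ<n j)) (<⇒≤ M<∣w∣)

    0<∣y∣ : 0 < length y
    0<∣y∣ = subst (0 <_) (sym ∣y∣≡j∸i) (m<n⇒0<n∸m i<j)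

  length-++-< : ∀ (x : List B) {y} z → 0 < length y → length (x ++ z) < length (x ++ y ++ z)
  length-++-< x {y} z 0<∣y∣ = begin-strict
    length (x ++ z)                  ≡⟨ length-++ x ⟩
    length x + length z              <⟨ +-monoʳ-< (length x) (m<n+m (length z) 0<∣y∣) ⟩
    length x + (length y + length z) ≡⟨ cong (length x +_) (length-++ y) ⟨
    length x + length (y ++ z)       ≡⟨ length-++ x ⟨
    length (x ++ y ++ z)             ∎
    where open ≤-Reasoning

  module _ {M} (f : List B → Fin M) (f-++ : ∀ {x y} z → f x ≡ f y → f (x ++ z) ≡ f (y ++ z)) where

    pump-down : ∀ w → ∃ λ w′ → w′ ⊆ w × length w′ ≤ M × f w′ ≡ f w
    pump-down w = go w (<-wellFounded (length w))
      where
      go : ∀ w → Acc _<_ (length w) → ∃ λ w′ → w′ ⊆ w × length w′ ≤ M × f w′ ≡ f w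
      go w (acc shorter) with length w ≤? M
      ... | yes ∣w∣≤M = w , ⊆-refl , ∣w∣≤M , refl
      ... | no ∣w∣≰M
        with x , y , z , refl , 0<∣y∣ , fx≡fxy ← prefix-pigeonhole f w (≰⇒> ∣w∣≰M)
        with w′ , w′⊆xz , ∣w′∣≤M , fw′≡fxz ← go (x ++ z) (shorter (length-++-< x z 0<∣y∣))
        = w′ , ⊆-trans w′⊆xz (++⁺ (⊆-refl {x = x}) (++⁺ˡ y ⊆-refl)) , ∣w′∣≤M ,
          trans fw′≡fxz (trans (f-++ z fx≡fxy) (cong f (++-assoc x y z)))

  words≤ : List B → ℕ → List (List B)
  words≤ bs zero    = [ [] ]
  words≤ bs (suc N) = [] ∷ cartesianProductWith _∷_ bs (words≤ bs N)

  ∈-words≤ : ∀ {bs} → (∀ b → b ∈ bs) → ∀ {N} w → length w ≤ N → w ∈ words≤ bs N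
  ∈-words≤ _    {zero}  []      _           = here refl
  ∈-words≤ _    {suc N} []      _           = here refl
  ∈-words≤ ∈-bs {suc N} (b ∷ w) (s≤s ∣w∣≤N) =
    there (∈-cartesianProductWith⁺ _∷_ (∈-bs b) (∈-words≤ ∈-bs w ∣w∣≤N))

Alternating : (ℕ → Bool) → ℕ → Set
Alternating f zero    = ⊤
Alternating f (suc d) = f 0 ≡ not (f 1) × Alternating (f ∘ suc) d

alternating? : ∀ f d → Dec (Alternating f d)
alternating? f zero    = yes tt
alternating? f (suc d) = (f 0 ≟ᵇ not (f 1)) ×-dec alternating? (f ∘ suc) d

Alternating-cong : ∀ {f g} d → (∀ {i} → i ≤ d → f i ≡ g i) → Alternating f d → Alternating g d
Alternating-cong zero    _   _               = tt
Alternating-cong (suc d) f≡g (f0≡¬f1 , rest) =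
  trans (sym (f≡g z≤n)) (trans f0≡¬f1 (cong not (f≡g (s≤s z≤n)))) ,
  Alternating-cong d (f≡g ∘ s≤s) rest

-- A chain w₀ ⊑ w₁ ⊑ ⋯ ⊑ w_d is stored as the word w_d with every letter labelled by the least i
-- such that the letter belongs to w_i; then w_i = layer i.
Labelled : Set → ℕ → Set
Labelled A p = List (A × Fin p)

module _ {A : Set} where

  layer : ∀ {p} → ℕ → Labelled A p → List A
  layer i []             = []
  layer i ((a , l) ∷ lw) = if toℕ l ≤ᵇ i then a ∷ layer i lw else layer i lw

  erase : ∀ {p} → Labelled A p → List A
  erase = map proj₁

  layer-++ : ∀ {p} i (x y : Labelled A p) → layer i (x ++ y) ≡ layer i x ++ layer i y
  layer-++ i []            y = refl
  layer-++ i ((a , l) ∷ x) y with toℕ l ≤ᵇ i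
  ... | true  = cong (a ∷_) (layer-++ i x y)
  ... | false = layer-++ i x y

  layer-⊆-erase : ∀ {p} i (lw : Labelled A p) → layer i lw ⊆ erase lw
  layer-⊆-erase i []             = []
  layer-⊆-erase i ((a , l) ∷ lw) with toℕ l ≤ᵇ i
  ... | true  = refl ∷ layer-⊆-erase i lw
  ... | false = a ∷ʳ layer-⊆-erase i lw

  layer-⊆-layer-suc : ∀ {p} i (lw : Labelled A p) → layer i lw ⊆ layer (suc i) lw
  layer-⊆-layer-suc i []             = []
  layer-⊆-layer-suc i ((a , l) ∷ lw)
    with toℕ l ≤ᵇ i | ≤ᵇ-reflects-≤ (toℕ l) i | toℕ l ≤ᵇ suc i | ≤ᵇ-reflects-≤ (toℕ l) (suc i)
  ... | true  | _       | true  | _         = refl ∷ layer-⊆-layer-suc i lw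
  ... | true  | ofʸ l≤i | false | ofⁿ l≰1+i = contradiction (m≤n⇒m≤1+n l≤i) l≰1+i
  ... | false | _       | true  | _         = a ∷ʳ layer-⊆-layer-suc i lw
  ... | false | _       | false | _         = layer-⊆-layer-suc i lw

  unlabelled : ∀ {p} → List A → Labelled A (suc p)
  unlabelled = map (_, zero)

  layer-unlabelled : ∀ {p} i (w : List A) → layer i (unlabelled {p} w) ≡ w
  layer-unlabelled i []      = refl
  layer-unlabelled i (a ∷ w) = cong (a ∷_) (layer-unlabelled i w)

  erase-unlabelled : ∀ {p} (w : List A) → erase (unlabelled {p} w) ≡ w
  erase-unlabelled w = trans (sym (map-∘ w)) (map-id w)

  refine : ∀ {p w} (lw : Labelled A p) → w ⊆ layer 0 lw → Labelled A (suc p)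
  refine []                 _         = []
  refine ((a , suc l) ∷ lw) w⊆        = (a , suc (suc l)) ∷ refine lw w⊆
  refine ((a , zero) ∷ lw)  (_ ∷ʳ w⊆) = (a , suc zero) ∷ refine lw w⊆
  refine ((a , zero) ∷ lw)  (_ ∷ w⊆)  = (a , zero) ∷ refine lw w⊆

  layer-0-refine : ∀ {p w} (lw : Labelled A p) (w⊆ : w ⊆ layer 0 lw) → layer 0 (refine lw w⊆) ≡ w
  layer-0-refine []                 []          = refl
  layer-0-refine ((a , suc l) ∷ lw) w⊆          = layer-0-refine lw w⊆
  layer-0-refine ((a , zero) ∷ lw)  (_ ∷ʳ w⊆)   = layer-0-refine lw w⊆
  layer-0-refine ((a , zero) ∷ lw)  (refl ∷ w⊆) = cong (a ∷_) (layer-0-refine lw w⊆)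

  layer-suc-refine : ∀ {p} i {w} (lw : Labelled A p) (w⊆ : w ⊆ layer 0 lw) →
    layer (suc i) (refine lw w⊆) ≡ layer i lw
  layer-suc-refine i []                 _         = refl
  layer-suc-refine i ((a , suc l) ∷ lw) w⊆        =
    cong (λ u → if suc (toℕ l) ≤ᵇ i then a ∷ u else u) (layer-suc-refine i lw w⊆)
  layer-suc-refine i ((a , zero) ∷ lw)  (_ ∷ʳ w⊆) = cong (a ∷_) (layer-suc-refine i lw w⊆)
  layer-suc-refine i ((a , zero) ∷ lw)  (_ ∷ w⊆)  = cong (a ∷_) (layer-suc-refine i lw w⊆)

  erase-refine : ∀ {p w} (lw : Labelled A p) (w⊆ : w ⊆ layer 0 lw) → erase (refine lw w⊆) ≡ erase lw
  erase-refine []                 _         = refl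
  erase-refine ((a , suc l) ∷ lw) w⊆        = cong (a ∷_) (erase-refine lw w⊆)
  erase-refine ((a , zero) ∷ lw)  (_ ∷ʳ w⊆) = cong (a ∷_) (erase-refine lw w⊆)
  erase-refine ((a , zero) ∷ lw)  (_ ∷ w⊆)  = cong (a ∷_) (erase-refine lw w⊆)

-- L± L true is Lplus L and L± L false is Lminus L, definitionally.
L± : ∀ {A} → Lang A → Bool → ℕ → Lang A
L± L c m v = ∃ λ w → (if c then L w else ¬ L w) × Chain L m w v

module Chains {A : Set} (L : Lang A) (member? : List A → Bool)
              (L-reflects : ∀ w → Reflects (L w) (member? w)) where

  profile : ∀ {p} → Labelled A p → ℕ → Bool
  profile lw i = member? (layer i lw)

  EncodesChain : ∀ {m} → Bool → Labelled A (suc m) → Set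
  EncodesChain {m} c lw = profile lw 0 ≡ c × Alternating (profile lw) m

  encodesChain? : ∀ {m} c (lw : Labelled A (suc m)) → Dec (EncodesChain c lw)
  encodesChain? {m} c lw = (profile lw 0 ≟ᵇ c) ×-dec alternating? (profile lw) m

  HasCodeBelow : Bool → ℕ → Lang A
  HasCodeBelow c m v = ∃ λ (lw : Labelled A (suc m)) → EncodesChain c lw × erase lw ⊆ v

  alternation : ∀ w w′ → (L w ⇔ (¬ L w′)) ⇔ (member? w ≡ not (member? w′))
  alternation w w′ = Reflects-⇔ (L-reflects w) (¬-reflects (L-reflects w′))

  ascending⇒chain : ∀ d (ws : ℕ → List A) {v} → (∀ i → ws i ⊆ ws (suc i)) → ws d ⊆ v →
    Alternating (member? ∘ ws) d → Chain L d (ws 0) v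
  ascending⇒chain zero    ws _   ws⊆v _            = done (⊆⇒⊑ ws⊆v)
  ascending⇒chain (suc d) ws asc ws⊆v (alt , rest) =
    step (⊆⇒⊑ (asc 0)) (Equivalence.from (alternation (ws 0) (ws 1)) alt)
      (ascending⇒chain d (ws ∘ suc) (asc ∘ suc) ws⊆v rest)

  labelled⇒chain : ∀ {p d v} (lw : Labelled A p) → erase lw ⊆ v → Alternating (profile lw) d →
    Chain L d (layer 0 lw) v
  labelled⇒chain {d = d} lw lw⊆v = ascending⇒chain d (λ i → layer i lw) (λ i → layer-⊆-layer-suc i lw)
    (⊆-trans (layer-⊆-erase d lw) lw⊆v)

  chain⇒labelled : ∀ {d w v} → Chain L d w v →
    ∃ λ (lw : Labelled A (suc d)) → layer 0 lw ≡ w × Alternating (profile lw) d × erase lw ⊆ v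
  chain⇒labelled {w = w} (done w⊑v) =
    unlabelled w , layer-unlabelled 0 w , tt , subst (_⊆ _) (sym (erase-unlabelled w)) (⊑⇒⊆ w⊑v)
  chain⇒labelled {w = w} (step w⊑w′ alt chain)
    with lw , refl , alternates , lw⊆v ← chain⇒labelled chain =
    refine lw w⊆ , layer-0-refine lw w⊆ ,
    (first-alternation , Alternating-cong _ (λ {i} _ → shifted i) alternates) ,
    subst (_⊆ _) (sym (erase-refine lw w⊆)) lw⊆v
    where
    w⊆ : w ⊆ layer 0 lw
    w⊆ = ⊑⇒⊆ w⊑w′
    shifted : ∀ i → profile lw i ≡ profile (refine lw w⊆) (suc i)
    shifted i = cong member? (sym (layer-suc-refine i lw w⊆))
    first-alternation : profile (refine lw w⊆) 0 ≡ not (profile (refine lw w⊆) 1)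
    first-alternation = subst₂ (λ u u′ → member? u ≡ not (member? u′))
      (sym (layer-0-refine lw w⊆)) (sym (layer-suc-refine 0 lw w⊆))
      (Equivalence.to (alternation w (layer 0 lw)) alt)

  L±⇔HasCodeBelow : ∀ c m v → L± L c m v ⇔ HasCodeBelow c m v
  L±⇔HasCodeBelow c m v = mk⇔ to from
    where
    to : L± L c m v → HasCodeBelow c m v
    to (w , polarity , chain) with lw , refl , alternates , lw⊆v ← chain⇒labelled chain =
      lw , (Equivalence.to (Reflects-if-⇔ (L-reflects w) c) polarity , alternates) , lw⊆v
    from : HasCodeBelow c m v → L± L c m v
    from (lw , (profile₀≡c , alternates) , lw⊆v) =
      layer 0 lw , Equivalence.from (Reflects-if-⇔ (L-reflects _) c) profile₀≡c ,
      labelled⇒chain lw lw⊆v alternates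

module _ {A : Set} {n : ℕ} (D : DFA A n) (m : ℕ) where
  open DFA D

  layer-states : Labelled A (suc m) → Fin (suc m) → Fin n
  layer-states lw j = foldl δ start (layer (toℕ j) lw)

  layer-states-code : Labelled A (suc m) → Fin (n ^ suc m)
  layer-states-code = funToFin ∘ layer-states

  layer-states-code-++ : ∀ {x y} z → layer-states-code x ≡ layer-states-code y →
    layer-states-code (x ++ z) ≡ layer-states-code (y ++ z)
  layer-states-code-++ {x} {y} z same = funToFin-cong λ j → begin
    foldl δ start (layer (toℕ j) (x ++ z))       ≡⟨ run-++ x j ⟩
    foldl δ (layer-states x j) (layer (toℕ j) z) ≡⟨ cong (flip (foldl δ) (layer (toℕ j) z)) (same-states j) ⟩
    foldl δ (layer-states y j) (layer (toℕ j) z) ≡⟨ run-++ y j ⟨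
    foldl δ start (layer (toℕ j) (y ++ z))       ∎
    where
    open ≡-Reasoning
    same-states : layer-states x ≗ layer-states y
    same-states = funToFin-injective {f = layer-states x} {layer-states y} same
    run-++ : ∀ u j →
      foldl δ start (layer (toℕ j) (u ++ z)) ≡ foldl δ (layer-states u j) (layer (toℕ j) z)
    run-++ u j = trans (cong (foldl δ start) (layer-++ (toℕ j) u z))
                       (foldl-++ δ start (layer (toℕ j) u) (layer (toℕ j) z))

  same-code⇒same-layer-states : ∀ {lw lw′} → layer-states-code lw′ ≡ layer-states-code lw →
    ∀ {i} → i ≤ m → foldl δ start (layer i lw′) ≡ foldl δ start (layer i lw)
  same-code⇒same-layer-states {lw} {lw′} same {i} i≤m =
    subst (λ k → foldl δ start (layer k lw′) ≡ foldl δ start (layer k lw)) (toℕ-fromℕ< (s≤s i≤m))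
      (funToFin-injective {f = layer-states lw′} {layer-states lw} same (fromℕ< (s≤s i≤m)))

module _ {A : Set} (letters : List A) (∈-letters : ∀ a → a ∈ letters)
         {n : ℕ} (D : DFA A n) (L : Lang A) (L⇔D : ∀ w → L w ⇔ accepts D w) (m : ℕ) where
  open DFA D

  member? : List A → Bool
  member? w = final (foldl δ start w)

  L-reflects : ∀ w → Reflects (L w) (member? w)
  L-reflects w = fromEquivalence (Equivalence.from (L⇔D w) ∘ Equivalence.to T-≡)
                                 (Equivalence.from T-≡ ∘ Equivalence.to (L⇔D w))

  open Chains L member? L-reflects

  EncodesChain⇒short : ∀ {c} (lw : Labelled A (suc m)) → EncodesChain c lw →
    ∃ λ lw′ → EncodesChain c lw′ × length lw′ ≤ n ^ suc m × erase lw′ ⊆ erase lw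
  EncodesChain⇒short lw (profile₀≡c , alternates)
    with lw′ , lw′⊆lw , short , same
           ← pump-down (layer-states-code D m) (λ {x} {y} → layer-states-code-++ D m {x} {y}) lw =
    lw′ , (trans (same-profile z≤n) profile₀≡c , Alternating-cong m (sym ∘ same-profile) alternates) ,
    short , map⁺ proj₁ lw′⊆lw
    where
    same-profile : ∀ {i} → i ≤ m → profile lw′ i ≡ profile lw i
    same-profile = cong final ∘ same-code⇒same-layer-states D m {lw} {lw′} same

  short-labelled-words : List (Labelled A (suc m))
  short-labelled-words = words≤ (cartesianProduct letters (allFin (suc m))) (n ^ suc m)

  patterns : Bool → List (List A)
  patterns c = map erase (filter (encodesChain? c) short-labelled-words)

  HasCodeBelow⇔patterns : ∀ c v → HasCodeBelow c m v ⇔ Any (λ p → Pattern p v) (patterns c)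
  HasCodeBelow⇔patterns c v = mk⇔ to from
    where
    to : HasCodeBelow c m v → Any (λ p → Pattern p v) (patterns c)
    to (lw , encodes , lw⊆v) with lw′ , encodes′ , short , lw′⊆lw ← EncodesChain⇒short lw encodes =
      lose (∈-map⁺ erase (∈-filter⁺ (encodesChain? c) (∈-words≤ ∈-labelled lw′ short) encodes′))
           (⊆⇒Pattern (⊆-trans lw′⊆lw lw⊆v))
      where
      ∈-labelled : ∀ (b : A × Fin (suc m)) → b ∈ cartesianProduct letters (allFin (suc m))
      ∈-labelled (a , l) = ∈-cartesianProduct⁺ (∈-letters a) (∈-allFin l)
    from : Any (λ p → Pattern p v) (patterns c) → HasCodeBelow c m v
    from matches with p , p∈patterns , match ← find matches
                 with lw , lw∈encoding , refl ← ∈-map⁻ erase p∈patterns =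
      lw , proj₂ (∈-filter⁻ (encodesChain? c) {xs = short-labelled-words} lw∈encoding) ,
      Pattern⇒⊆ _ match

  L±-InL½ : ∀ c → InL½ (L± L c m)
  L±-InL½ c = patterns c , λ v → ⇔-trans (L±⇔HasCodeBelow c m v) (HasCodeBelow⇔patterns c v)

corollary3p6 : (k : ℕ) → k ≥ 2 → (L : List (Fin k) → Set) → Regular L → (m : ℕ) →
    InL½ (Lplus L m) × InL½ (Lminus L m)
corollary3p6 k _ L (n , D , L⇔D) m =
  L±-InL½ (allFin k) ∈-allFin D L L⇔D m true , L±-InL½ (allFin k) ∈-allFin D L L⇔D m false
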